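{- Let $w$ be a double occurrence word over an alphabet $\Sigma$ with $|w|=2n$, and suppose $w$ is not equal to $w_{TC_n}$ up to renaming of letters. Let $\sigma\subseteq\Sigma$ be a non-empty subset of letters of minimal size such that every word in $w\setminus\sigma$ has even length, and let $k=|\sigma|$. Then $w(\sigma)$ is the tangled cord word $w_{TC_k}$ up to renaming of letters (equivalently, $\Gamma_{w(\sigma)}$ is the tangled cord $TC_k$).
   Context: A double occurrence word is a non-empty word in which each letter occurs exactly twice or not at all. For a set of letters $\sigma$, $w(\sigma)$ is the word obtained by concatenating all occurrences of letters of $\sigma$ in $w$ in their order in $w$, and $w\setminus\sigma$ is the sequence of non-empty subwords obtained from $w$ by deleting all occurrences of letters of $\sigma$ (the maximal contiguous blocks of $w$ with no letter of $\sigma$). The tangled cord word is $w_{TC_k}=1\,2\,1\,3\,2\,4\,3\dots k\,(k-1)\,k$ (e.g. $w_{TC_1}=11$, $w_{TC_3}=121323$); double occurrence words correspond bijectively (up to renaming and reversal, and $w_{TC_k}$ is invariant under reversal plus renaming) to simple assembly graphs, and the tangled cord $TC_k$ is the graph of $w_{TC_k}$. -}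

module Defs where

open import Data.Nat using (ℕ; zero; suc; _*_; _≤_)
open import Data.Nat.Properties using (_≟_)
open import Data.List using (List; []; _∷_; _++_; length; filter)
open import Data.List.Membership.Propositional using (_∈_; _∉_)
open import Data.List.Membership.DecPropositional _≟_ using (_∈?_)
open import Data.List.Relation.Unary.All using (All)
open import Data.List.Relation.Unary.Unique.Propositional using (Unique)
open import Data.Product using (Σ; ∃; ∃-syntax; _×_)
open import Relation.Nullary using (¬_; yes; no)
open import Relation.Binary.PropositionalEquality using (_≡_)

Word : Set
Word = List ℕ

occ : ℕ → Word → ℕ
occ a w = length (filter (_≟ a) w)

DOW : Word → Set
DOW w = (¬ (w ≡ [])) × (∀ a → a ∈ w → occ a w ≡ 2)

restrict : Word → List ℕ → Word
restrict w σ = filter (_∈? σ) w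

-- w \ σ : maximal non-empty contiguous blocks of w containing no letter of σ
-- (helper carries the current, reversed-free, partial block)
private
  flush : Word → List Word → List Word
  flush [] bs = bs
  flush b  bs = b ∷ bs

  go : List ℕ → Word → Word → List Word
  go σ cur [] = flush cur []
  go σ cur (x ∷ w) with x ∈? σ
  ... | yes _ = flush cur (go σ [] w)
  ... | no  _ = go σ (cur ++ (x ∷ [])) w

delete : Word → List ℕ → List Word
delete w σ = go σ [] w

Even : ℕ → Set
Even n = ∃[ m ] n ≡ 2 * m

SubsetOfLetters : List ℕ → Word → Set
SubsetOfLetters σ w = Unique σ × All (_∈ w) σ

NonEmpty : List ℕ → Set
NonEmpty σ = ¬ (σ ≡ [])

EvenSplit : Word → List ℕ → Set
EvenSplit w σ = All (λ b → Even (length b)) (delete w σ)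

_≈ren_ : Word → Word → Set
u ≈ren v = Σ (ℕ → ℕ) λ f →
  (∀ x y → x ∈ u → y ∈ u → f x ≡ f y → x ≡ y) × (Data.List.map f u ≡ v)

-- tangled cord word  w_TC_k = 1 2 1 3 2 4 3 … k (k-1) k   (meaningful for k ≥ 1)
tcMid : ℕ → Word
tcMid zero = []
tcMid (suc zero) = []
tcMid (suc (suc m)) = tcMid (suc m) ++ (suc (suc m) ∷ suc m ∷ [])

wTC : ℕ → Word
wTC k = 1 ∷ (tcMid k ++ (k ∷ []))

{-# OPTIONS --safe #-}
module Submission where

open import Defs
open import Data.Bool using (Bool; true; false; if_then_else_; _∨_; not)
import Data.Bool.Properties as Bool
open import Data.Empty using (⊥-elim)
open import Data.List using (List; []; _∷_; _++_; length; filter; map)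
open import Data.List.Membership.Propositional using (_∈_; _∉_; find)
open import Data.List.Membership.Propositional.Properties
  using (∈-filter⁺; ∈-filter⁻; ∈-++⁺ˡ; ∈-++⁺ʳ; ∈-map⁺; ∈-∃++)
open import Data.List.Properties
  using (length-++; ++-assoc; ∷-injective; ∷ʳ-injective; map-++; map-id; map-cong-local;
         filter-++; filter-accept; filter-reject; filter-notAll)
open import Data.List.Relation.Binary.Permutation.Propositional
  using (_↭_; prep; swap; ↭-refl; ↭-sym; module PermutationReasoning)
open import Data.List.Relation.Binary.Permutation.Propositional.Properties
  using (↭-length; filter-↭; shift; ++⁺ˡ; ∈-resp-↭)
import Data.List.Relation.Binary.Permutation.Propositional.Properties as ↭
open import Data.List.Relation.Unary.All using (All; []; _∷_)
import Data.List.Relation.Unary.All as All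
import Data.List.Relation.Unary.All.Properties as All
open import Data.List.Relation.Unary.Any using (Any; here; there)
import Data.List.Relation.Unary.Any as Any
import Data.List.Relation.Unary.Any.Properties as Any
open import Data.List.Relation.Unary.Unique.Propositional using (Unique; []; _∷_)
import Data.List.Relation.Unary.Unique.Propositional.Properties as Unique
open import Data.Maybe using (Maybe; just; nothing; _>>=_)
open import Data.Maybe.Properties using (just-injective)
open import Data.Nat using (ℕ; zero; suc; _+_; _*_; _≤_; _<_; z≤n; s≤s; _≤?_; parity)
open import Data.Nat.Properties
  using (_≟_; ≤-refl; n≤1+n; n<1+n; m≤n⇒m≤1+n; m<n⇒m<1+n; m<1+n⇒m<n∨m≡n; ≤⇒≯; <⇒≢; <⇒≱;
         +-assoc; +-comm; +-suc; +-cancelʳ-≡; suc-injective; 1+n≢0)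
open import Data.List.Membership.DecPropositional _≟_ using (_∈?_)
open import Data.Parity.Base using (Parity; 0ℙ; 1ℙ; _⁻¹)
import Data.Parity.Base as ℙ
open import Data.Parity.Properties using (⁻¹-involutive; ⁻¹-selfInverse; suc-homo-⁻¹; *-homo-*)
open import Data.Product using (∃-syntax; _×_; _,_; proj₁; proj₂)
open import Data.Sum using (_⊎_; inj₁; inj₂)
open import Function.Base using (id; _∋_; case_of_)
open import Relation.Binary.PropositionalEquality
open import Relation.Nullary using (Dec; yes; no; ¬_; does)
open import Relation.Nullary.Decidable using (dec-true; dec-false)
open import Relation.Unary using (Decidable)

-- Call u minimal if every set P of letters that splits u into blocks of even length and
-- contains a letter of u contains all of them. If σ is a smallest non-empty even-splitting set
-- for w, then w(σ) is minimal: the letters of w outside σ already form even blocks, so a subset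
-- of σ splits w(σ) evenly iff it splits w evenly, and σ ∩ P would be a smaller choice than σ.
-- Minimal double occurrence words are tangled cords, by induction on the number of letters.
-- Write u = v p q. If p = q, the letters other than p split u evenly. Otherwise u = v₁ q v₂ p q,
-- and u′ = v₁ p v₂ is again minimal (rename q to p and drop the final p p), hence a tangled cord
-- A z B. Renaming q to a fresh letter M turns u into A M B z M, and unless z is the last letter
-- of the cord, {M} or {1, …, z − 1, M} splits this word evenly (depending on the parity of the
-- position of z); so minimality leaves only the next tangled cord.

double : ℕ → ℕ
double zero    = zero
double (suc n) = suc (suc (double n))

parity-double : ∀ n → parity (double n) ≡ 0ℙ
parity-double zero    = refl
parity-double (suc n) = parity-double n

parity-double-+ : ∀ i n → parity (double i + n) ≡ parity n
parity-double-+ zero    n = refl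
parity-double-+ (suc i) n = parity-double-+ i n

Even⇒parity≡0ℙ : ∀ {n} → Even n → parity n ≡ 0ℙ
Even⇒parity≡0ℙ (m , refl) = *-homo-* 2 m

parity≡0ℙ⇒Even : ∀ n → parity n ≡ 0ℙ → Even n
parity≡0ℙ⇒Even zero          _ = 0 , refl
parity≡0ℙ⇒Even (suc (suc n)) e with m , refl ← parity≡0ℙ⇒Even n e =
  suc m , cong suc (sym (+-suc m (m + 0)))

even-or-odd : ∀ n → (∃[ i ] n ≡ double i) ⊎ (∃[ i ] n ≡ suc (double i))
even-or-odd zero = inj₁ (0 , refl)
even-or-odd (suc n) with even-or-odd n
... | inj₁ (i , refl) = inj₂ (i , refl)
... | inj₂ (i , refl) = inj₁ (suc i , refl)

length-∷ʳ : ∀ (xs : Word) x → length (xs ++ x ∷ []) ≡ suc (length xs)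
length-∷ʳ xs x = trans (length-++ xs) (+-comm (length xs) 1)

parity-length-∷ʳ : ∀ (xs : Word) x → parity (length (xs ++ x ∷ [])) ≡ parity (length xs) ⁻¹
parity-length-∷ʳ xs x =
  trans (cong parity (length-∷ʳ xs x)) (sym (⁻¹-selfInverse (suc-homo-⁻¹ (length xs))))

-- Even blocks

-- `scan P p w` reads w keeping the parity p of the current block of letters outside P,
-- and fails as soon as a letter of P closes a block of odd length.
step : Bool → Parity → Maybe Parity
step true  0ℙ = just 0ℙ
step true  1ℙ = nothing
step false p  = just (p ⁻¹)

scan : (ℕ → Bool) → Parity → Word → Maybe Parity
scan P p []      = just p
scan P p (x ∷ w) = step (P x) p >>= λ p′ → scan P p′ w

EvenBlocks : (ℕ → Bool) → Word → Set
EvenBlocks P w = scan P 0ℙ w ≡ just 0ℙ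

scan-++ : ∀ P p xs ys → scan P p (xs ++ ys) ≡ (scan P p xs >>= λ p′ → scan P p′ ys)
scan-++ P p []       ys = refl
scan-++ P p (x ∷ xs) ys with step (P x) p
... | nothing = refl
... | just p′ = scan-++ P p′ xs ys

scan-++-just : ∀ P {p p′} xs {ys} → scan P p xs ≡ just p′ → scan P p (xs ++ ys) ≡ scan P p′ ys
scan-++-just P {p} xs {ys} e = trans (scan-++ P p xs ys) (cong (_>>= λ p′ → scan P p′ ys) e)

scan-cong : ∀ {P Q} p {xs} → All (λ y → P y ≡ Q y) xs → scan P p xs ≡ scan Q p xs
scan-cong p [] = refl
scan-cong {Q = Q} p {x ∷ _} (e ∷ es) rewrite e with step (Q x) p
... | nothing = refl
... | just p′ = scan-cong p′ es

scan-map : ∀ P g p xs → scan P p (map g xs) ≡ scan (λ y → P (g y)) p xs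
scan-map P g p []       = refl
scan-map P g p (x ∷ xs) with step (P (g x)) p
... | nothing = refl
... | just p′ = scan-map P g p′ xs

EvenBlocks-++ : ∀ {P} xs {ys} → EvenBlocks P xs → EvenBlocks P ys → EvenBlocks P (xs ++ ys)
EvenBlocks-++ {P} xs xs-even ys-even = trans (scan-++-just P xs xs-even) ys-even

EvenBlocks-inside : ∀ {P xs} → All (λ y → P y ≡ true) xs → EvenBlocks P xs
EvenBlocks-inside []                    = refl
EvenBlocks-inside (Px ∷ Pxs) rewrite Px = EvenBlocks-inside Pxs

EvenBlocks-outside : ∀ {P xs} → All (λ y → P y ≡ false) xs → parity (length xs) ≡ 0ℙ → EvenBlocks P xs
EvenBlocks-outside []                  _ = refl
EvenBlocks-outside (Px ∷ Py ∷ Pxs) e rewrite Px | Py = EvenBlocks-outside Pxs e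

EvenBlocks-closed : ∀ {P} xs {a} → All (λ y → P y ≡ false) xs → parity (length xs) ≡ 0ℙ → P a ≡ true →
                    EvenBlocks P (xs ++ a ∷ [])
EvenBlocks-closed {P} xs outside even Pa =
  EvenBlocks-++ {P} xs (EvenBlocks-outside {P} outside even) (EvenBlocks-inside {P} (Pa ∷ []))

EvenBlocks-pair : ∀ {P} a b → P a ≡ P b → EvenBlocks P (a ∷ b ∷ [])
EvenBlocks-pair {P} a b Pa≡Pb = both (P b) Pa≡Pb refl
  where
  both : ∀ c → P a ≡ c → P b ≡ c → EvenBlocks P (a ∷ b ∷ [])
  both true  Pa Pb = EvenBlocks-inside {P} (Pa ∷ Pb ∷ [])
  both false Pa Pb = EvenBlocks-outside {P} (Pa ∷ Pb ∷ []) refl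

mem : List ℕ → ℕ → Bool
mem σ y = does (y ∈? σ)

mem⇒∈ : ∀ {σ y} → mem σ y ≡ true → y ∈ σ
mem⇒∈ {σ} {y} e  with y ∈? σ
mem⇒∈ {σ} {y} _  | yes y∈σ = y∈σ
mem⇒∈ {σ} {y} () | no _

-- `delete` runs a scanner that Defs keeps private. Solving the meta `segments` against the
-- unfolding of `delete`, with `[]` abstracted to a variable, recovers that scanner in full
-- generality, so that its recursion can be followed.
mutual
  private
    segments : List ℕ → Word → Word → List Word
    segments = _

    delete≡segments : ∀ w σ → delete w σ ≡ segments σ [] w
    delete≡segments w σ with Word ∋ []
    ... | c = refl

EvenLength : Word → Set
EvenLength b = Even (length b)

segments⇒scan : ∀ σ c w → All EvenLength (segments σ c w) → scan (mem σ) (parity (length c)) w ≡ just 0ℙ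
segments⇒scan σ []      []      _          = refl
segments⇒scan σ (y ∷ c) []      (e ∷ [])   = cong just (Even⇒parity≡0ℙ e)
segments⇒scan σ c       (x ∷ w) h          with x ∈? σ
segments⇒scan σ []      (x ∷ w) h          | yes _ = segments⇒scan σ [] w h
segments⇒scan σ (y ∷ c) (x ∷ w) (e ∷ h)    | yes _ rewrite Even⇒parity≡0ℙ e = segments⇒scan σ [] w h
segments⇒scan σ c       (x ∷ w) h          | no _ =
  subst (λ p → scan (mem σ) p w ≡ just 0ℙ) (parity-length-∷ʳ c x) (segments⇒scan σ (c ++ x ∷ []) w h)

scan⇒segments : ∀ σ c w → scan (mem σ) (parity (length c)) w ≡ just 0ℙ → All EvenLength (segments σ c w)
scan⇒segments σ []      []      _ = []
scan⇒segments σ (y ∷ c) []      e = parity≡0ℙ⇒Even _ (just-injective e) ∷ []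
scan⇒segments σ c       (x ∷ w) h with x ∈? σ
scan⇒segments σ []      (x ∷ w) h  | yes _ = scan⇒segments σ [] w h
scan⇒segments σ (y ∷ c) (x ∷ w) h  | yes _ with parity (suc (length c)) in e
scan⇒segments σ (y ∷ c) (x ∷ w) h  | yes _ | 0ℙ = parity≡0ℙ⇒Even _ e ∷ scan⇒segments σ [] w h
scan⇒segments σ (y ∷ c) (x ∷ w) () | yes _ | 1ℙ
scan⇒segments σ c       (x ∷ w) h  | no _ =
  scan⇒segments σ (c ++ x ∷ []) w
    (subst (λ p → scan (mem σ) p w ≡ just 0ℙ) (sym (parity-length-∷ʳ c x)) h)

EvenSplit⇒EvenBlocks : ∀ w σ → EvenSplit w σ → EvenBlocks (mem σ) w
EvenSplit⇒EvenBlocks w σ h = segments⇒scan σ [] w (subst (All EvenLength) (delete≡segments w σ) h)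

EvenBlocks⇒EvenSplit : ∀ w σ → EvenBlocks (mem σ) w → EvenSplit w σ
EvenBlocks⇒EvenSplit w σ h = subst (All EvenLength) (sym (delete≡segments w σ)) (scan⇒segments σ [] w h)

-- Minimal words

Minimal : Word → Set
Minimal u = ∀ P → EvenBlocks P u → Any (λ y → P y ≡ true) u → All (λ y → P y ≡ true) u

EvenBlocks⇒¬Minimal : ∀ {u} P {a b} → EvenBlocks P u → a ∈ u → P a ≡ true → b ∈ u → P b ≡ false →
                      ¬ Minimal u
EvenBlocks⇒¬Minimal P even a∈u Pa b∈u Pb minimal =
  Bool.not-¬ Pb (All.lookup (minimal P even (Any.map (λ { refl → Pa }) a∈u)) b∈u)

Minimal-map : ∀ g {u} → Minimal u → Minimal (map g u)
Minimal-map g {u} minimal P even some =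
  All.map⁺ (minimal (λ y → P (g y)) (trans (sym (scan-map P g 0ℙ u)) even) (Any.map⁻ some))

Minimal-++-pair⁻ : ∀ {u} a → Minimal (u ++ a ∷ a ∷ []) → Minimal u
Minimal-++-pair⁻ {u} a minimal P even some =
  All.++⁻ˡ u (minimal P (EvenBlocks-++ {P} u even (EvenBlocks-pair {P} a a refl)) (Any.++⁺ˡ some))

repeated-end-¬Minimal : ∀ {v p} → v ≢ [] → p ∉ v → ¬ Minimal (v ++ p ∷ p ∷ [])
repeated-end-¬Minimal {[]}    v≢[] _ = ⊥-elim (v≢[] refl)
repeated-end-¬Minimal {y ∷ v} {p} _ p∉v =
  EvenBlocks⇒¬Minimal P (EvenBlocks-++ {P} (y ∷ v) (EvenBlocks-inside {P} inside) (EvenBlocks-pair {P} p p refl))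
                      (here refl) (All.head inside)
                      (∈-++⁺ʳ (y ∷ v) (here refl)) (cong not (dec-true (p ≟ p) refl))
  where
  P : ℕ → Bool
  P t = not (does (t ≟ p))
  inside : All (λ t → P t ≡ true) (y ∷ v)
  inside = All.tabulate λ {t} t∈ → cong not (dec-false (t ≟ p) λ { refl → p∉v t∈ })

EveryLetterTwice : Word → Set
EveryLetterTwice u = ∀ y → y ∈ u → occ y u ≡ 2

occ-++ : ∀ y xs ys → occ y (xs ++ ys) ≡ occ y xs + occ y ys
occ-++ y xs ys = trans (cong length (filter-++ (_≟ y) xs ys)) (length-++ (filter (_≟ y) xs))

occ-here : ∀ y xs → occ y (y ∷ xs) ≡ suc (occ y xs)
occ-here y xs = cong length (filter-accept (_≟ y) refl)

occ-there : ∀ {x} y xs → x ≢ y → occ y (x ∷ xs) ≡ occ y xs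
occ-there y xs x≢y = cong length (filter-reject (_≟ y) x≢y)

∈⇒occ≢0 : ∀ {y xs} → y ∈ xs → occ y xs ≢ 0
∈⇒occ≢0 {y} {x ∷ xs} y∈ with x ≟ y | y∈
... | yes refl | _         = λ e → 1+n≢0 (trans (sym (occ-here y xs)) e)
... | no x≢y   | here refl = ⊥-elim (x≢y refl)
... | no x≢y   | there y∈′ = λ e → ∈⇒occ≢0 y∈′ (trans (sym (occ-there y xs x≢y)) e)

occ≡suc⇒∈ : ∀ {y n} xs → occ y xs ≡ suc n → y ∈ xs
occ≡suc⇒∈ {y} (x ∷ xs) e with x ≟ y
... | yes refl = here refl
... | no x≢y   = there (occ≡suc⇒∈ xs (trans (sym (occ-there y xs x≢y)) e))

occ-resp-↭ : ∀ y {xs ys} → xs ↭ ys → occ y xs ≡ occ y ys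
occ-resp-↭ y xs↭ys = ↭-length (filter-↭ (_≟ y) xs↭ys)

occ-restrict : ∀ {y σ} w → y ∈ σ → occ y (restrict w σ) ≡ occ y w
occ-restrict [] _ = refl
occ-restrict {y} {σ} (x ∷ w) y∈σ with x ∈? σ
... | no x∉σ = trans (occ-restrict w y∈σ) (sym (occ-there {x} y w λ { refl → x∉σ y∈σ }))
... | yes _ with x ≟ y
...   | yes refl = trans (occ-here y _) (trans (cong suc (occ-restrict w y∈σ)) (sym (occ-here y w)))
...   | no x≢y   = trans (occ-there y _ x≢y) (trans (occ-restrict w y∈σ) (sym (occ-there y w x≢y)))

restrict-EveryLetterTwice : ∀ {w} σ → EveryLetterTwice w → EveryLetterTwice (restrict w σ)
restrict-EveryLetterTwice {w} σ twice y y∈ =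
  let y∈w , y∈σ = ∈-filter⁻ (_∈? σ) {xs = w} y∈ in trans (occ-restrict w y∈σ) (twice y y∈w)

length-restrict-∷ : ∀ {s σ} w → s ∉ σ → length (restrict w (s ∷ σ)) ≡ occ s w + length (restrict w σ)
length-restrict-∷ [] _ = refl
length-restrict-∷ {s} {σ} (x ∷ w) s∉σ with x ≟ s
... | yes refl = begin
  length (restrict (x ∷ w) (x ∷ σ))            ≡⟨ cong length (filter-accept (_∈? x ∷ σ) (here refl)) ⟩
  suc (length (restrict w (x ∷ σ)))            ≡⟨ cong suc (length-restrict-∷ w s∉σ) ⟩
  suc (occ x w) + length (restrict w σ)        ≡⟨ cong₂ (λ n v → n + length v) (sym (occ-here x w))
                                                         (sym (filter-reject (_∈? σ) s∉σ)) ⟩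
  occ x (x ∷ w) + length (restrict (x ∷ w) σ)  ∎
  where open ≡-Reasoning
... | no x≢s =
  trans (same-step (x ∈? σ)) (cong (_+ length (restrict (x ∷ w) σ)) (sym (occ-there s w x≢s)))
  where
  open ≡-Reasoning
  same-step : Dec (x ∈ σ) → length (restrict (x ∷ w) (s ∷ σ)) ≡ occ s w + length (restrict (x ∷ w) σ)
  same-step (yes x∈σ) = begin
    length (restrict (x ∷ w) (s ∷ σ))      ≡⟨ cong length (filter-accept (_∈? s ∷ σ) (there x∈σ)) ⟩
    suc (length (restrict w (s ∷ σ)))      ≡⟨ cong suc (length-restrict-∷ w s∉σ) ⟩
    suc (occ s w + length (restrict w σ))  ≡⟨ +-suc (occ s w) _ ⟨
    occ s w + suc (length (restrict w σ))  ≡⟨ cong (λ v → occ s w + length v) (filter-accept (_∈? σ) x∈σ) ⟨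
    occ s w + length (restrict (x ∷ w) σ)  ∎
  same-step (no x∉σ) = begin
    length (restrict (x ∷ w) (s ∷ σ))      ≡⟨ cong length (filter-reject (_∈? s ∷ σ) x∉s∷σ) ⟩
    length (restrict w (s ∷ σ))            ≡⟨ length-restrict-∷ w s∉σ ⟩
    occ s w + length (restrict w σ)        ≡⟨ cong (λ v → occ s w + length v) (filter-reject (_∈? σ) x∉σ) ⟨
    occ s w + length (restrict (x ∷ w) σ)  ∎
    where
    x∉s∷σ : x ∉ s ∷ σ
    x∉s∷σ (here x≡s)  = x≢s x≡s
    x∉s∷σ (there x∈σ) = x∉σ x∈σ

length-restrict : ∀ {σ w} → Unique σ → All (_∈ w) σ → EveryLetterTwice w →
                  length (restrict w σ) ≡ double (length σ)
length-restrict {[]} {w} [] [] _ = restrict-[] w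
  where
  restrict-[] : ∀ w → length (restrict w []) ≡ 0
  restrict-[] []      = refl
  restrict-[] (x ∷ w) = restrict-[] w
length-restrict {s ∷ σ} {w} (s∉σ ∷ σ-unique) (s∈w ∷ σ⊆w) twice =
  trans (length-restrict-∷ w (λ s∈σ → All.lookup s∉σ s∈σ refl))
        (cong₂ _+_ (twice s s∈w) (length-restrict σ-unique σ⊆w twice))

-- Letters outside σ are outside Q, so the parity of the open Q-block of w is the sum of the
-- parities of the open σ-block of w and of the open Q-block of w(σ).
scan-restrict : ∀ {σ Q} → (∀ {y} → Q y ≡ true → y ∈ σ) → ∀ w s t →
                scan (mem σ) s w ≡ just 0ℙ → scan Q (s ℙ.+ t) w ≡ scan Q t (restrict w σ)
scan-restrict Q⊆σ [] s t e = cong (λ s → just (s ℙ.+ t)) (just-injective e)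
scan-restrict {σ} {Q} Q⊆σ (x ∷ w) s t e with x ∈? σ
scan-restrict {σ} {Q} Q⊆σ (x ∷ w) 0ℙ t e | yes _ with step (Q x) t
... | nothing = refl
... | just t′ = scan-restrict Q⊆σ w 0ℙ t′ e
scan-restrict {σ} {Q} Q⊆σ (x ∷ w) 1ℙ t () | yes _
scan-restrict {σ} {Q} Q⊆σ (x ∷ w) s t e | no x∉σ with Q x in Qx
... | true  = ⊥-elim (x∉σ (Q⊆σ Qx))
... | false with s
...   | 0ℙ = scan-restrict Q⊆σ w 1ℙ t e
...   | 1ℙ = trans (cong (λ p → scan Q p w) (⁻¹-involutive t)) (scan-restrict Q⊆σ w 0ℙ t e)

restrict-Minimal : ∀ w σ → SubsetOfLetters σ w → EvenSplit w σ →
                   (∀ τ → SubsetOfLetters τ w → NonEmpty τ → EvenSplit w τ → length σ ≤ length τ) →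
                   Minimal (restrict w σ)
restrict-Minimal w σ (σ-unique , σ⊆w) σ-even σ-minimum P P-even P-some = All.tabulate P-all
  where
  P? : Decidable (λ a → P a ≡ true)
  P? a = P a Bool.≟ true

  τ : List ℕ
  τ = filter P? σ

  ∈σ : ∀ {y} → y ∈ restrict w σ → y ∈ σ
  ∈σ y∈ = proj₂ (∈-filter⁻ (_∈? σ) {xs = w} y∈)

  mem-τ : ∀ {a} → a ∈ σ → mem τ a ≡ P a
  mem-τ {a} a∈σ with P a in Pa
  ... | true  = dec-true (a ∈? τ) (∈-filter⁺ P? a∈σ Pa)
  ... | false = dec-false (a ∈? τ) λ a∈τ → Bool.not-¬ Pa (proj₂ (∈-filter⁻ P? {xs = σ} a∈τ))

  τ-even : EvenBlocks (mem τ) w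
  τ-even = begin
    scan (mem τ) 0ℙ w               ≡⟨ scan-restrict (λ e → proj₁ (∈-filter⁻ P? (mem⇒∈ e))) w 0ℙ 0ℙ
                                                     (EvenSplit⇒EvenBlocks w σ σ-even) ⟩
    scan (mem τ) 0ℙ (restrict w σ)  ≡⟨ scan-cong 0ℙ (All.tabulate (λ y∈ → mem-τ (∈σ y∈))) ⟩
    scan P 0ℙ (restrict w σ)        ≡⟨ P-even ⟩
    just 0ℙ                         ∎
    where open ≡-Reasoning

  τ≢[] : NonEmpty τ
  τ≢[] τ≡[] with y , y∈ , Py ← find P-some with () ← subst (y ∈_) τ≡[] (∈-filter⁺ P? (∈σ y∈) Py)

  σ≤τ : length σ ≤ length τ
  σ≤τ = σ-minimum τ (Unique.filter⁺ P? σ-unique , All.filter⁺ P? σ⊆w) τ≢[]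
                    (EvenBlocks⇒EvenSplit w τ τ-even)

  P-all : ∀ {y} → y ∈ restrict w σ → P y ≡ true
  P-all {y} y∈ with P y in Py
  ... | true  = refl
  ... | false = ⊥-elim (≤⇒≯ σ≤τ (filter-notAll P? σ (Any.map (λ { refl → Bool.not-¬ Py }) (∈σ y∈))))

-- Tangled cords

length-1∷tcMid : ∀ m → length (1 ∷ tcMid (suc m)) ≡ suc (double m)
length-1∷tcMid zero    = refl
length-1∷tcMid (suc m) = begin
  length (1 ∷ tcMid (suc (suc m)))  ≡⟨ length-++ (1 ∷ tcMid (suc m)) ⟩
  length (1 ∷ tcMid (suc m)) + 2    ≡⟨ cong (_+ 2) (length-1∷tcMid m) ⟩
  suc (double m + 2)                ≡⟨ cong suc (+-comm (double m) 2) ⟩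
  suc (double (suc m))              ∎
  where open ≡-Reasoning

length-wTC : ∀ m → length (wTC (suc m)) ≡ double (suc m)
length-wTC m = trans (length-∷ʳ (1 ∷ tcMid (suc m)) (suc m)) (cong suc (length-1∷tcMid m))

1∷tcMid-≤ : ∀ m → All (_≤ suc m) (1 ∷ tcMid (suc m))
1∷tcMid-≤ zero    = s≤s z≤n ∷ []
1∷tcMid-≤ (suc m) = All.++⁺ (All.map m≤n⇒m≤1+n (1∷tcMid-≤ m)) (≤-refl ∷ n≤1+n _ ∷ [])

wTC-≤ : ∀ m → All (_≤ suc m) (wTC (suc m))
wTC-≤ m = All.++⁺ (1∷tcMid-≤ m) (≤-refl ∷ [])

wTC-bounds : ∀ {m A z B} → A ++ z ∷ B ≡ wTC (suc m) → All (_≤ suc m) A × z ≤ suc m × All (_≤ suc m) B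
wTC-bounds {m} {A} eq with A≤ , z≤ ∷ B≤ ← All.++⁻ A (subst (All (_≤ suc m)) (sym eq) (wTC-≤ m)) =
  A≤ , z≤ , B≤

tcMid-split : ∀ {i m} → i < m →
              ∃[ D ] tcMid (suc m) ≡ tcMid (suc i) ++ suc (suc i) ∷ suc i ∷ D × All (suc i <_) D
tcMid-split {i} {suc m} i<1+m with m<1+n⇒m<n∨m≡n i<1+m
... | inj₂ refl = [] , refl , []
... | inj₁ i<m with D , mid≡ , D> ← tcMid-split i<m =
  D ++ suc (suc m) ∷ suc m ∷ [] ,
  trans (cong (_++ suc (suc m) ∷ suc m ∷ []) mid≡) (++-assoc (tcMid (suc i)) _ _) ,
  All.++⁺ D> (m<n⇒m<1+n (s≤s i<m) ∷ s≤s i<m ∷ [])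

wTC-split : ∀ {i m} → i < m →
            ∃[ R ] wTC (suc m) ≡ (1 ∷ tcMid (suc i)) ++ suc (suc i) ∷ suc i ∷ R × All (suc i <_) R
wTC-split {i} {m} i<m with D , mid≡ , D> ← tcMid-split i<m =
  D ++ suc m ∷ [] ,
  cong (1 ∷_) (trans (cong (_++ suc m ∷ []) mid≡) (++-assoc (tcMid (suc i)) _ _)) ,
  All.++⁺ D> (s≤s i<m ∷ [])

graft : ℕ → Word → ℕ → Word → Word
graft M A z B = (A ++ M ∷ B) ++ z ∷ M ∷ []

graft-++ : ∀ M A z B₁ B₂ → graft M A z (B₁ ++ B₂) ≡ (A ++ M ∷ B₁) ++ (B₂ ++ z ∷ []) ++ M ∷ []
graft-++ M A z B₁ B₂ = begin
  (A ++ M ∷ B₁ ++ B₂) ++ z ∷ M ∷ []          ≡⟨ ++-assoc A (M ∷ B₁ ++ B₂) _ ⟩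
  A ++ M ∷ (B₁ ++ B₂) ++ z ∷ M ∷ []          ≡⟨ cong (λ t → A ++ M ∷ t) (++-assoc B₁ B₂ _) ⟩
  A ++ M ∷ B₁ ++ B₂ ++ z ∷ M ∷ []            ≡⟨ cong (λ t → A ++ M ∷ B₁ ++ t) (++-assoc B₂ (z ∷ []) _) ⟨
  A ++ M ∷ B₁ ++ (B₂ ++ z ∷ []) ++ M ∷ []    ≡⟨ ++-assoc A (M ∷ B₁) _ ⟨
  (A ++ M ∷ B₁) ++ (B₂ ++ z ∷ []) ++ M ∷ []  ∎
  where open ≡-Reasoning

graft-↭ : ∀ q v₁ p v₂ → graft q v₁ p v₂ ↭ q ∷ q ∷ v₁ ++ p ∷ v₂
graft-↭ q v₁ p v₂ = begin
  (v₁ ++ q ∷ v₂) ++ p ∷ q ∷ []  ≡⟨ ++-assoc v₁ (q ∷ v₂) _ ⟩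
  v₁ ++ q ∷ v₂ ++ p ∷ q ∷ []    ↭⟨ shift q v₁ _ ⟩
  q ∷ v₁ ++ v₂ ++ p ∷ q ∷ []    ↭⟨ prep q (++⁺ˡ v₁ (↭.++-comm v₂ (p ∷ q ∷ []))) ⟩
  q ∷ v₁ ++ p ∷ q ∷ v₂          ↭⟨ prep q (++⁺ˡ v₁ (swap p q ↭-refl)) ⟩
  q ∷ v₁ ++ q ∷ p ∷ v₂          ↭⟨ prep q (shift q v₁ (p ∷ v₂)) ⟩
  q ∷ q ∷ v₁ ++ p ∷ v₂          ∎
  where open PermutationReasoning

graft-¬Minimal : ∀ P {M} A {z} B₁ B₂ → EvenBlocks P (A ++ M ∷ B₁) → P M ≡ true →
                 All (λ y → P y ≡ false) (B₂ ++ z ∷ []) → parity (length (B₂ ++ z ∷ [])) ≡ 0ℙ →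
                 ¬ Minimal (graft M A z (B₁ ++ B₂))
graft-¬Minimal P {M} A {z} B₁ B₂ prefix PM outside even =
  EvenBlocks⇒¬Minimal P blocks (∈-++⁺ˡ (∈-++⁺ʳ A (here refl))) PM (∈-++⁺ʳ (A ++ M ∷ B₁ ++ B₂) (here refl))
                      (All.lookup outside (∈-++⁺ʳ B₂ (here refl)))
  where
  blocks : EvenBlocks P (graft M A z (B₁ ++ B₂))
  blocks = subst (EvenBlocks P) (sym (graft-++ M A z B₁ B₂))
                 (EvenBlocks-++ {P} (A ++ M ∷ B₁) prefix (EvenBlocks-closed {P} (B₂ ++ z ∷ []) outside even PM))

prefix-parity : ∀ {m A z B} k i → A ++ z ∷ B ≡ wTC (suc m) → length A ≡ k + double i →
                parity (k + suc (length B)) ≡ 0ℙ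
prefix-parity {m} {A} {z} {B} k i eq |A| = begin
  parity (k + suc (length B))               ≡⟨ parity-double-+ i _ ⟨
  parity (double i + (k + suc (length B)))  ≡⟨ cong parity (+-assoc (double i) k _) ⟨
  parity (double i + k + suc (length B))    ≡⟨ cong (λ n → parity (n + suc (length B)))
                                                    (trans (+-comm (double i) k) (sym |A|)) ⟩
  parity (length A + suc (length B))        ≡⟨ cong parity (trans (sym (length-++ A)) (cong length eq)) ⟩
  parity (length (wTC (suc m)))             ≡⟨ cong parity (length-wTC m) ⟩
  parity (double (suc m))                   ≡⟨ parity-double (suc m) ⟩
  0ℙ                                        ∎
  where open ≡-Reasoning

graft-evenPrefix : ∀ {m A z B i} → A ++ z ∷ B ≡ wTC (suc m) → length A ≡ double i →
                   ¬ Minimal (graft (suc (suc m)) A z B)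
graft-evenPrefix {m} {A} {z} {B} {i} eq |A| with A≤ , z≤ , B≤ ← wTC-bounds eq =
  graft-¬Minimal P A [] B (EvenBlocks-closed {P} A (All.map outside A≤) A-even PM) PM
                 (All.map outside (All.++⁺ B≤ (z≤ ∷ [])))
                 (trans (cong parity (length-∷ʳ B z)) (prefix-parity 0 i eq |A|))
  where
  P : ℕ → Bool
  P y = does (suc (suc m) ≤? y)
  PM : P (suc (suc m)) ≡ true
  PM = dec-true (suc (suc m) ≤? suc (suc m)) ≤-refl
  outside : ∀ {y} → y ≤ suc m → P y ≡ false
  outside {y} y≤ = dec-false (suc (suc m) ≤? y) (<⇒≱ (s≤s y≤))
  A-even : parity (length A) ≡ 0ℙ
  A-even = trans (cong parity |A|) (parity-double i)

odd-prefix-bound : ∀ {m A z b B i} → A ++ z ∷ b ∷ B ≡ wTC (suc m) → length A ≡ suc (double i) → i < m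
odd-prefix-bound {m} {A} {z} {b} {B} {i} eq |A| =
  bound i m (trans (cong (_+ _) (sym |A|)) (trans (sym (length-++ A)) (trans (cong length eq) (length-wTC m))))
  where
  bound : ∀ i m → suc (double i) + suc (suc (length B)) ≡ double (suc m) → i < m
  bound zero    (suc m) _ = s≤s z≤n
  bound (suc i) (suc m) e = s≤s (bound i m (suc-injective (suc-injective e)))

++-injective-length : ∀ {a} {X : Set a} (xs ys : List X) {xs′ ys′ : List X} → length xs ≡ length ys →
                      xs ++ xs′ ≡ ys ++ ys′ → xs ≡ ys × xs′ ≡ ys′
++-injective-length []       []       _   eq = refl , eq
++-injective-length (x ∷ xs) (y ∷ ys) len eq
  with refl , eq′ ← ∷-injective eq
  with refl , eq″ ← ++-injective-length xs ys (suc-injective len) eq′ = refl , eq″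

-- A is the prefix 1 2 1 3 2 … (i+1) i of the cord, so z = i+2 and B is i+1 followed by letters above i+1.
graft-oddPrefix : ∀ {m A z b B i} → A ++ z ∷ b ∷ B ≡ wTC (suc m) → length A ≡ suc (double i) →
                  ¬ Minimal (graft (suc (suc m)) A z (b ∷ B))
graft-oddPrefix {m} {A} {z} {b} {B} {i} eq |A|
  with _ , z≤ , _ ∷ B≤ ← wTC-bounds eq
  with R , wTC≡ , R> ← wTC-split (odd-prefix-bound eq |A|)
  with refl , refl ← ++-injective-length A (1 ∷ tcMid (suc i))
                        (trans |A| (sym (length-1∷tcMid i))) (trans eq wTC≡) =
  graft-¬Minimal P A (suc i ∷ []) R
    (EvenBlocks-inside {P} (All.++⁺ (All.map inside (1∷tcMid-≤ i)) (PM ∷ inside ≤-refl ∷ [])))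
    PM
    (All.zipWith (λ (y> , y≤) → outside y> y≤) (All.++⁺ R> (n<1+n _ ∷ []) , All.++⁺ B≤ (z≤ ∷ [])))
    (trans (cong parity (length-∷ʳ R z)) (prefix-parity 1 i eq |A|))
  where
  P : ℕ → Bool
  P y = does (y ≤? suc i) ∨ does (suc (suc m) ≤? y)
  PM : P (suc (suc m)) ≡ true
  PM = trans (cong (does (suc (suc m) ≤? suc i) ∨_) (dec-true (suc (suc m) ≤? suc (suc m)) ≤-refl))
             (Bool.∨-zeroʳ _)
  inside : ∀ {y} → y ≤ suc i → P y ≡ true
  inside {y} y≤ = cong (_∨ does (suc (suc m) ≤? y)) (dec-true (y ≤? suc i) y≤)
  outside : ∀ {y} → suc i < y → y ≤ suc m → P y ≡ false
  outside {y} y> y≤ =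
    cong₂ _∨_ (dec-false (y ≤? suc i) (<⇒≱ y>)) (dec-false (suc (suc m) ≤? y) (<⇒≱ (s≤s y≤)))

Minimal-graft⇒wTC : ∀ m A z B → A ++ z ∷ B ≡ wTC (suc m) → Minimal (graft (suc (suc m)) A z B) →
                    graft (suc (suc m)) A z B ≡ wTC (suc (suc m))
Minimal-graft⇒wTC m A z [] eq _ with refl , refl ← ∷ʳ-injective A (1 ∷ tcMid (suc m)) eq =
  cong (1 ∷_) (trans (++-assoc (tcMid (suc m)) _ _) (sym (++-assoc (tcMid (suc m)) _ _)))
Minimal-graft⇒wTC m A z (b ∷ B) eq minimal with even-or-odd (length A)
... | inj₁ (i , |A|) = ⊥-elim (graft-evenPrefix eq |A| minimal)
... | inj₂ (i , |A|) = ⊥-elim (graft-oddPrefix eq |A| minimal)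

_[_↦_] : ∀ {a} {X : Set a} → (ℕ → X) → ℕ → X → ℕ → X
(f [ a ↦ b ]) y = if does (y ≟ a) then b else f y

update-≡ : ∀ {a} {X : Set a} (f : ℕ → X) x b → (f [ x ↦ b ]) x ≡ b
update-≡ f x b = cong (λ c → if c then b else f x) (dec-true (x ≟ x) refl)

update-≢ : ∀ {a} {X : Set a} (f : ℕ → X) {x} b {y} → y ≢ x → (f [ x ↦ b ]) y ≡ f y
update-≢ f {x} b {y} y≢x = cong (λ c → if c then b else f y) (dec-false (y ≟ x) y≢x)

map-update-∉ : ∀ (f : ℕ → ℕ) {x} b {v} → x ∉ v → map (f [ x ↦ b ]) v ≡ map f v
map-update-∉ f b x∉v = map-cong-local (All.tabulate λ y∈v → update-≢ f b λ { refl → x∉v y∈v })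

map-update-graft : ∀ f b {q v₁ p v₂} → q ∉ v₁ → q ∉ v₂ → p ≢ q →
                   map (f [ q ↦ b ]) (graft q v₁ p v₂) ≡ graft b (map f v₁) (f p) (map f v₂)
map-update-graft f b {q} {v₁} {p} {v₂} q∉v₁ q∉v₂ p≢q = begin
  map g (graft q v₁ p v₂)                  ≡⟨ map-++ g (v₁ ++ q ∷ v₂) _ ⟩
  map g (v₁ ++ q ∷ v₂) ++ g p ∷ g q ∷ []   ≡⟨ cong (_++ g p ∷ g q ∷ []) (map-++ g v₁ (q ∷ v₂)) ⟩
  graft (g q) (map g v₁) (g p) (map g v₂)  ≡⟨ cong₂ (λ A B → graft (g q) A (g p) B)
                                                    (map-update-∉ f b q∉v₁) (map-update-∉ f b q∉v₂) ⟩
  graft (g q) (map f v₁) (g p) (map f v₂)  ≡⟨ cong₂ (λ M z → graft M (map f v₁) z (map f v₂))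
                                                    (update-≡ f q b) (update-≢ f b p≢q) ⟩
  graft b (map f v₁) (f p) (map f v₂)      ∎
  where
  open ≡-Reasoning
  g = f [ q ↦ b ]

InjectiveOn : (ℕ → ℕ) → Word → Set
InjectiveOn f u = ∀ x y → x ∈ u → y ∈ u → f x ≡ f y → x ≡ y

update-injectiveOn : ∀ {f u u′ a b} → InjectiveOn f u → (∀ {y} → y ∈ u → f y ≢ b) →
                     (∀ {y} → y ∈ u′ → y ∈ a ∷ u) → InjectiveOn (f [ a ↦ b ]) u′
update-injectiveOn {f} {u} {u′} {a} {b} f-inj fresh u′⊆a∷u x y x∈ y∈ gx≡gy = cases (x ≟ a) (y ≟ a)
  where
  ∈u : ∀ {z} → z ∈ u′ → z ≢ a → z ∈ u
  ∈u z∈ z≢a with u′⊆a∷u z∈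
  ... | here z≡a  = ⊥-elim (z≢a z≡a)
  ... | there z∈u = z∈u

  at-a : ∀ {z} → z ≡ a → (f [ a ↦ b ]) z ≡ b
  at-a refl = update-≡ f a b

  cases : Dec (x ≡ a) → Dec (y ≡ a) → x ≡ y
  cases (yes x≡a) (yes y≡a) = trans x≡a (sym y≡a)
  cases (yes x≡a) (no y≢a)  =
    ⊥-elim (fresh (∈u y∈ y≢a) (trans (sym (update-≢ f b y≢a)) (trans (sym gx≡gy) (at-a x≡a))))
  cases (no x≢a)  (yes y≡a) =
    ⊥-elim (fresh (∈u x∈ x≢a) (trans (sym (update-≢ f b x≢a)) (trans gx≡gy (at-a y≡a))))
  cases (no x≢a)  (no y≢a)  = f-inj x y (∈u x∈ x≢a) (∈u y∈ y≢a)
                                (trans (sym (update-≢ f b x≢a)) (trans gx≡gy (update-≢ f b y≢a)))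

Minimal-graft⁻ : ∀ {q v₁ p v₂} → q ∉ v₁ → q ∉ v₂ → p ≢ q → Minimal (graft q v₁ p v₂) → Minimal (v₁ ++ p ∷ v₂)
Minimal-graft⁻ {q} {v₁} {p} {v₂} q∉v₁ q∉v₂ p≢q minimal =
  Minimal-++-pair⁻ p (subst Minimal collapse (Minimal-map (id [ q ↦ p ]) minimal))
  where
  collapse : map (id [ q ↦ p ]) (graft q v₁ p v₂) ≡ (v₁ ++ p ∷ v₂) ++ p ∷ p ∷ []
  collapse = trans (map-update-graft id p q∉v₁ q∉v₂ p≢q)
                   (cong₂ (λ A B → graft p A p B) (map-id v₁) (map-id v₂))

-- Minimal words are tangled cords

module Contraction {v₁ v₂ p q} (p≢q : p ≢ q) (twice : EveryLetterTwice (graft q v₁ p v₂)) where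

  u′ : Word
  u′ = v₁ ++ p ∷ v₂

  occ-u′ : ∀ y → occ y (graft q v₁ p v₂) ≡ occ y (q ∷ q ∷ u′)
  occ-u′ y = occ-resp-↭ y (graft-↭ q v₁ p v₂)

  q∉u′ : q ∉ u′
  q∉u′ q∈u′ = ∈⇒occ≢0 q∈u′ (suc-injective (suc-injective (begin
    suc (suc (occ q u′))     ≡⟨ trans (occ-here q (q ∷ u′)) (cong suc (occ-here q u′)) ⟨
    occ q (q ∷ q ∷ u′)       ≡⟨ occ-u′ q ⟨
    occ q (graft q v₁ p v₂)  ≡⟨ twice q (∈-++⁺ʳ (v₁ ++ q ∷ v₂) (there (here refl))) ⟩
    2                        ∎)))
    where open ≡-Reasoning

  q∉v₁ : q ∉ v₁
  q∉v₁ q∈v₁ = q∉u′ (∈-++⁺ˡ q∈v₁)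

  q∉v₂ : q ∉ v₂
  q∉v₂ q∈v₂ = q∉u′ (∈-++⁺ʳ v₁ (there q∈v₂))

  ⊆q∷u′ : ∀ {y} → y ∈ graft q v₁ p v₂ → y ∈ q ∷ u′
  ⊆q∷u′ y∈ with ∈-resp-↭ (graft-↭ q v₁ p v₂) y∈
  ... | here y≡q  = here y≡q
  ... | there y∈′ = y∈′

  twice′ : EveryLetterTwice u′
  twice′ y y∈u′ = begin
    occ y u′                 ≡⟨ trans (occ-there y (q ∷ u′) q≢y) (occ-there y u′ q≢y) ⟨
    occ y (q ∷ q ∷ u′)       ≡⟨ occ-u′ y ⟨
    occ y (graft q v₁ p v₂)  ≡⟨ twice y (∈-resp-↭ (↭-sym (graft-↭ q v₁ p v₂)) (there (there y∈u′))) ⟩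
    2                        ∎
    where
    open ≡-Reasoning
    q≢y : q ≢ y
    q≢y refl = q∉u′ y∈u′

  length′ : ∀ {m} → length (graft q v₁ p v₂) ≡ double (suc (suc m)) → length u′ ≡ double (suc m)
  length′ len = suc-injective (suc-injective (trans (sym (↭-length (graft-↭ q v₁ p v₂))) len))

  minimal′ : Minimal (graft q v₁ p v₂) → Minimal u′
  minimal′ = Minimal-graft⁻ q∉v₁ q∉v₂ p≢q

  extend : ∀ {m} → u′ ≈ren wTC (suc m) → Minimal (graft q v₁ p v₂) → graft q v₁ p v₂ ≈ren wTC (suc (suc m))
  extend {m} (f , f-inj , f-map) minimal =
    g , update-injectiveOn f-inj fresh ⊆q∷u′ ,
    trans g-map (Minimal-graft⇒wTC m (map f v₁) (f p) (map f v₂) f-map′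
                                   (subst Minimal g-map (Minimal-map g minimal)))
    where
    g : ℕ → ℕ
    g = f [ q ↦ suc (suc m) ]
    g-map : map g (graft q v₁ p v₂) ≡ graft (suc (suc m)) (map f v₁) (f p) (map f v₂)
    g-map = map-update-graft f (suc (suc m)) q∉v₁ q∉v₂ p≢q
    f-map′ : map f v₁ ++ f p ∷ map f v₂ ≡ wTC (suc m)
    f-map′ = trans (sym (map-++ f v₁ (p ∷ v₂))) f-map
    fresh : ∀ {y} → y ∈ u′ → f y ≢ suc (suc m)
    fresh y∈ = <⇒≢ (s≤s (All.lookup (wTC-≤ m) (subst (_ ∈_) f-map (∈-map⁺ f y∈))))

repeated-end-∉ : ∀ {p} v → occ p (v ++ p ∷ p ∷ []) ≡ 2 → p ∉ v
repeated-end-∉ {p} v twice p∈v = ∈⇒occ≢0 p∈v (+-cancelʳ-≡ 2 (occ p v) 0 (begin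
  occ p v + 2                   ≡⟨ cong (occ p v +_) (trans (occ-here p _) (cong suc (occ-here p []))) ⟨
  occ p v + occ p (p ∷ p ∷ [])  ≡⟨ occ-++ p v _ ⟨
  occ p (v ++ p ∷ p ∷ [])       ≡⟨ twice ⟩
  2                             ∎))
  where open ≡-Reasoning

distinct-end-∈ : ∀ {p q} v → p ≢ q → occ q (v ++ p ∷ q ∷ []) ≡ 2 → q ∈ v
distinct-end-∈ {p} {q} v p≢q twice = occ≡suc⇒∈ v (+-cancelʳ-≡ 1 (occ q v) 1 (begin
  occ q v + 1                   ≡⟨ cong (occ q v +_) (trans (occ-there q _ p≢q) (occ-here q [])) ⟨
  occ q v + occ q (p ∷ q ∷ [])  ≡⟨ occ-++ q v _ ⟨
  occ q (v ++ p ∷ q ∷ [])       ≡⟨ twice ⟩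
  2                             ∎))
  where open ≡-Reasoning

last-two : ∀ (u : Word) → 2 ≤ length u → ∃[ v ] ∃[ p ] ∃[ q ] u ≡ v ++ p ∷ q ∷ []
last-two (a ∷ [])        (s≤s ())
last-two (a ∷ b ∷ [])    _ = [] , a , b , refl
last-two (a ∷ b ∷ c ∷ u) _ with v , p , q , eq ← last-two (b ∷ c ∷ u) (s≤s (s≤s z≤n)) =
  a ∷ v , p , q , cong (a ∷_) eq

Minimal⇒wTC : ∀ m u → length u ≡ double (suc m) → EveryLetterTwice u → Minimal u → u ≈ren wTC (suc m)
Minimal⇒wTC zero    []              () _     _
Minimal⇒wTC zero    (a ∷ [])        () _     _
Minimal⇒wTC zero    (a ∷ b ∷ _ ∷ _) () _     _
Minimal⇒wTC zero    (a ∷ b ∷ [])    _  twice _ with b ≟ a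
... | yes refl = (λ _ → 1) , (λ x y x∈ y∈ _ → trans (only-a x∈) (sym (only-a y∈))) , refl
  where
  only-a : ∀ {x} → x ∈ a ∷ a ∷ [] → x ≡ a
  only-a (here x≡a)         = x≡a
  only-a (there (here x≡a)) = x≡a
... | no b≢a =
  case trans (sym (twice a (here refl))) (trans (occ-here a (b ∷ [])) (cong suc (occ-there a [] b≢a))) of λ ()
Minimal⇒wTC (suc m) u len twice minimal with last-two u (subst (2 ≤_) (sym len) (s≤s (s≤s z≤n)))
... | v , p , q , refl with p ≟ q
...   | yes refl = ⊥-elim (repeated-end-¬Minimal (λ { refl → case len of λ () })
                                                 (repeated-end-∉ v (twice p (∈-++⁺ʳ v (here refl)))) minimal)
...   | no p≢q
  with v₁ , v₂ , refl ← ∈-∃++ (distinct-end-∈ v p≢q (twice q (∈-++⁺ʳ v (there (here refl))))) =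
  extend (Minimal⇒wTC m u′ (length′ len) twice′ (minimal′ minimal)) minimal
  where open Contraction p≢q twice

corollary4p9 : (w : Word) (n : ℕ) → DOW w → length w ≡ 2 * n →
    ¬ (w ≈ren wTC n) →
    (σ : List ℕ) → SubsetOfLetters σ w → NonEmpty σ → EvenSplit w σ →
    ((τ : List ℕ) → SubsetOfLetters τ w → NonEmpty τ → EvenSplit w τ →
      length σ ≤ length τ) →
    restrict w σ ≈ren wTC (length σ)
corollary4p9 w _ _ _ _ [] _ σ≢[] _ _ = ⊥-elim (σ≢[] refl)
corollary4p9 w _ (_ , twice) _ _ σ@(_ ∷ σ′) letters@(σ-unique , σ⊆w) _ even minimum =
  Minimal⇒wTC (length σ′) (restrict w σ)
    (length-restrict σ-unique σ⊆w twice)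
    (restrict-EveryLetterTwice σ twice)
    (restrict-Minimal w σ letters even minimum)
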